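{- For every nontrivial connected graph $G$, $\alpha_h(G) < 4\alpha(G)$, where $\alpha(G)$ is the independence number of $G$.
   Context: A broadcast on a nontrivial connected graph $G$ is a function $f:V(G)\to\{0,1,\dots,\operatorname{diam}(G)\}$ with $f(v)\le e(v)$ (the eccentricity of $v$) for every $v$. Let $V_f^+=\{v: f(v)>0\}$. A vertex $u$ hears $f$ from $v\in V_f^+$ if $d_G(u,v)\le f(v)$; $N_f(v)$ denotes the set of vertices hearing $f$ from $v$. The broadcast $f$ is hearing independent if for any two distinct $x,v\in V_f^+$, $x\notin N_f(v)$. The cost of $f$ is $\sigma(f)=\sum_v f(v)$, and $\alpha_h(G)$ is the maximum cost of a hearing independent broadcast on $G$. -}

module Defs where

open import Data.Nat using (ℕ; zero; suc; _+_; _≤_; _<_; _∸_)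
open import Data.Fin using (Fin)
open import Data.Fin.Subset using (Subset; _∈_; ∣_∣)
open import Data.Product using (Σ; ∃; _×_; _,_)
open import Data.Empty using (⊥)
open import Relation.Nullary using (¬_)
open import Relation.Binary.PropositionalEquality using (_≡_)
open import Data.Vec.Functional using (foldr)

record Graph : Set₁ where
  field
    n     : ℕ
    Adj   : Fin n → Fin n → Set
    sym   : ∀ {u v} → Adj u v → Adj v u
    irrefl : ∀ {u} → ¬ Adj u u
open Graph public

data Walk (G : Graph) : Fin (n G) → Fin (n G) → ℕ → Set where
  here : ∀ {u} → Walk G u u zero
  step : ∀ {u w v k} → Adj G u w → Walk G w v k → Walk G u v (suc k)

Within : (G : Graph) → Fin (n G) → Fin (n G) → ℕ → Set
Within G u v k = Σ ℕ λ m → m ≤ k × Walk G u v m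

Connected : Graph → Set
Connected G = ∀ u v → Σ ℕ λ k → Within G u v k

Nontrivial : Graph → Set
Nontrivial G = 2 ≤ n G

IsDist : (G : Graph) → Fin (n G) → Fin (n G) → ℕ → Set
IsDist G u v d = Within G u v d × (∀ m → m < d → ¬ Within G u v m)

IsEcc : (G : Graph) → Fin (n G) → ℕ → Set
IsEcc G v e = (∀ u d → IsDist G v u d → d ≤ e) × (Σ (Fin (n G)) λ u → IsDist G v u e)

-- broadcast: f(v) ≤ e(v) for all v (this also gives f(v) ≤ diam(G))
IsBroadcast : (G : Graph) → (Fin (n G) → ℕ) → Set
IsBroadcast G f = ∀ v e → IsEcc G v e → f v ≤ e

HearingIndependent : (G : Graph) → (Fin (n G) → ℕ) → Set
HearingIndependent G f =
  ∀ x v → ¬ x ≡ v → 0 < f x → 0 < f v → ¬ Within G x v (f v)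

cost : {m : ℕ} → (Fin m → ℕ) → ℕ
cost f = foldr _+_ 0 f

Independent : (G : Graph) → Subset (n G) → Set
Independent G S = ∀ u v → u ∈ S → v ∈ S → ¬ Adj G u v

IsIndependenceNumber : Graph → ℕ → Set
IsIndependenceNumber G a =
  (Σ (Subset (n G)) λ S → Independent G S × ∣ S ∣ ≡ a)
  × (∀ S → Independent G S → ∣ S ∣ ≤ a)

-- Let s be a vertex of maximum broadcast value.  From every vertex v there is a
-- geodesic of length e(v) ≥ f(v); on it take the points at positions
-- 0, 2, 4, …, ⌈f(v)/4⌉ of them (⌈(f(s)+1)/4⌉ for s).  Two points on one
-- geodesic are at distance at least 2.  If point i of v and point j of x ≠ v
-- were at distance at most 1, then d(v, x) ≤ 2i + 1 + 2j, which is at most the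
-- larger of f(v), f(x) while the smaller one is positive, so one of v, x would
-- hear the other.  Hence the points form an independent set of more than
-- σ(f)/4 vertices.
module Submission where

open import Defs
open import Data.Empty using (⊥-elim)
open import Data.Fin using (Fin; zero; suc; toℕ; fromℕ<; _≟_)
open import Data.Fin.Properties using (any?; toℕ<n)
open import Data.Fin.Subset using (Subset; ⁅_⁆; _∪_; ⊥; ∣_∣) renaming (_∈_ to _∈ₛ_)
open import Data.Fin.Subset.Properties
  using (∉⊥; x∈p∪q⁻; x∈p∪q⁺; x∈⁅y⁆⇒x≡y; x∈⁅x⁆; q⊆p∪q; p⊂q⇒∣p∣<∣q∣)
open import Data.List using (List; []; _∷_; length; concat; tabulate; allFin)
open import Data.List.Properties using (length-++; length-tabulate)
open import Data.List.Extrema.Nat using (argmax; f[xs]≤f[argmax])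
open import Data.List.Membership.Propositional using (_∈_)
open import Data.List.Membership.Propositional.Properties using (∈-allFin)
open import Data.List.Relation.Unary.Any using (here; there)
import Data.List.Relation.Unary.All as All
import Data.List.Relation.Unary.All.Properties as All
open import Data.List.Relation.Unary.AllPairs as AllPairs using (AllPairs; []; _∷_)
import Data.List.Relation.Unary.AllPairs.Properties as AllPairs
open import Data.List.Relation.Unary.Unique.Propositional using (Unique)
open import Data.Nat using (ℕ; zero; suc; _+_; _*_; _∸_; _≤_; _<_; z≤n; s≤s; s≤s⁻¹; _≤?_; _<?_)
open import Data.Nat.DivMod using (_/_; _%_; m/n*n≤m; m≡m%n+[m/n]*n; m%n<n)
open import Data.Nat.Properties
  using ( ≤-refl; ≤-reflexive; ≤-trans; ≤-antisym; <⇒≤; <-≤-trans; ≮⇒≥; <⇒≱; ≰⇒≥; n<1+n; m≤m+n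
        ; +-comm; *-comm; +-identityʳ; *-zeroʳ; *-distribˡ-+; m+[n∸m]≡n; +-cancelʳ-≤; *-cancelˡ-<
        ; +-mono-≤; +-monoˡ-≤; +-monoʳ-≤; +-monoˡ-<; +-mono-<-≤; +-mono-≤-<; *-monoˡ-≤; *-monoʳ-≤
        ; anyUpTo?; module ≤-Reasoning )
open import Data.Nat.Tactic.RingSolver using (solve)
open import Data.Product using (Σ; _×_; _,_; proj₁; proj₂)
open import Data.Sum using (_⊎_; inj₁; inj₂)
open import Data.Vec.Functional using (foldr)
open import Function using (_∘_)
open import Relation.Binary using (Decidable)
open import Relation.Binary.PropositionalEquality as ≡ using (_≡_; _≢_; refl; cong; trans; subst)
open import Relation.Nullary using (¬_; Dec; yes; no; map′; contradiction)
open import Relation.Nullary.Decidable using (_×-dec_; decidable-stable; ¬¬-excluded-middle)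
open import Relation.Nullary.Negation using (¬¬-map)

module _ {G : Graph} where

  private
    Vertex = Fin (n G)

  _++ʷ_ : ∀ {u v w k m} → Walk G u v k → Walk G v w m → Walk G u w (k + m)
  here     ++ʷ q = q
  step e p ++ʷ q = step e (p ++ʷ q)

  _∷ʳʷ_ : ∀ {u v w k} → Walk G u v k → Adj G v w → Walk G u w (suc k)
  here     ∷ʳʷ e = step e here
  step e p ∷ʳʷ e′ = step e (p ∷ʳʷ e′)

  reverseʷ : ∀ {u v k} → Walk G u v k → Walk G v u k
  reverseʷ here       = here
  reverseʷ (step e p) = reverseʷ p ∷ʳʷ sym G e

  walk⇒within : ∀ {u v k} → Walk G u v k → Within G u v k
  walk⇒within p = _ , ≤-refl , p

  within-mono : ∀ {u v k k′} → k ≤ k′ → Within G u v k → Within G u v k′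
  within-mono k≤k′ (m , m≤k , p) = m , ≤-trans m≤k k≤k′ , p

  within-sym : ∀ {u v k} → Within G u v k → Within G v u k
  within-sym (m , m≤k , p) = m , m≤k , reverseʷ p

  within-trans : ∀ {u v w k m} → Within G u v k → Within G v w m → Within G u w (k + m)
  within-trans (k′ , k′≤k , p) (m′ , m′≤m , q) = k′ + m′ , +-mono-≤ k′≤k m′≤m , p ++ʷ q

  isDist-≤ : ∀ {u v d k} → IsDist G u v d → Within G u v k → d ≤ k
  isDist-≤ {k = k} (_ , minimal) w = ≮⇒≥ (λ k<d → minimal k k<d w)

  vertexAt : ∀ {u v ℓ} → Walk G u v ℓ → ℕ → Vertex
  vertexAt {u} p          zero    = u
  vertexAt {u} here       (suc k) = u
  vertexAt     (step _ p) (suc k) = vertexAt p k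

  prefix : ∀ {u v ℓ} (p : Walk G u v ℓ) k → k ≤ ℓ → Walk G u (vertexAt p k) k
  prefix p          zero    _         = here
  prefix (step e p) (suc k) (s≤s k≤ℓ) = step e (prefix p k k≤ℓ)

  suffix : ∀ {u v ℓ} (p : Walk G u v ℓ) k → Walk G (vertexAt p k) v (ℓ ∸ k)
  suffix p          zero    = p
  suffix here       (suc k) = here
  suffix (step _ p) (suc k) = suffix p k

  record Geodesic (u v : Vertex) (ℓ : ℕ) : Set where
    field
      walk     : Walk G u v ℓ
      shortest : ∀ {m} → Within G u v m → ℓ ≤ m

  isDist⇒geodesic : ∀ {u v d} → IsDist G u v d → Geodesic u v d
  isDist⇒geodesic {d = d} dist@((m , m≤d , p) , _) =
    record { walk = subst (Walk G _ _) m≡d p ; shortest = isDist-≤ dist }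
    where
      m≡d : m ≡ d
      m≡d = ≤-antisym m≤d (isDist-≤ dist (walk⇒within p))

  -- Splicing a shortcut of length r between positions j < k would beat the geodesic.
  geodesic-apart : ∀ {u v ℓ} (γ : Geodesic u v ℓ) {j k r} → j + r < k → k ≤ ℓ →
                   let p = Geodesic.walk γ in ¬ Within G (vertexAt p j) (vertexAt p k) r
  geodesic-apart {ℓ = ℓ} γ {j} {k} {r} j+r<k k≤ℓ close =
    <⇒≱ shortcut<ℓ (Geodesic.shortest γ shortcut)
    where
      p = Geodesic.walk γ
      j≤ℓ : j ≤ ℓ
      j≤ℓ = ≤-trans (m≤m+n j r) (<⇒≤ (<-≤-trans j+r<k k≤ℓ))
      shortcut : Within G _ _ (j + r + (ℓ ∸ k))
      shortcut = within-trans (within-trans (walk⇒within (prefix p j j≤ℓ)) close)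
                              (walk⇒within (suffix p k))
      shortcut<ℓ : j + r + (ℓ ∸ k) < ℓ
      shortcut<ℓ = subst (j + r + (ℓ ∸ k) <_) (m+[n∸m]≡n k≤ℓ) (+-monoˡ-< (ℓ ∸ k) j+r<k)

⌈_/4⌉ : ℕ → ℕ
⌈ y /4⌉ = (y + 3) / 4

<⌈/4⌉⇒4*< : ∀ {i} y → i < ⌈ y /4⌉ → 4 * i < y
<⌈/4⌉⇒4*< {i} y i<q = +-cancelʳ-≤ 3 (suc (4 * i)) y (begin
  suc (4 * i) + 3   ≡⟨ solve (i ∷ []) ⟩
  suc i * 4         ≤⟨ *-monoˡ-≤ 4 i<q ⟩
  ⌈ y /4⌉ * 4       ≤⟨ m/n*n≤m (y + 3) 4 ⟩
  y + 3             ∎)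
  where open ≤-Reasoning

≤4*⌈/4⌉ : ∀ y → y ≤ 4 * ⌈ y /4⌉
≤4*⌈/4⌉ y = +-cancelʳ-≤ 3 y (4 * ⌈ y /4⌉) (begin
  y + 3                           ≡⟨ m≡m%n+[m/n]*n (y + 3) 4 ⟩
  (y + 3) % 4 + ⌈ y /4⌉ * 4       ≤⟨ +-monoˡ-≤ (⌈ y /4⌉ * 4) (s≤s⁻¹ (m%n<n (y + 3) 4)) ⟩
  3 + ⌈ y /4⌉ * 4                 ≡⟨ +-comm 3 _ ⟩
  ⌈ y /4⌉ * 4 + 3                 ≡⟨ cong (_+ 3) (*-comm ⌈ y /4⌉ 4) ⟩
  4 * ⌈ y /4⌉ + 3                 ∎)
  where open ≤-Reasoning

-- 2(2i + 1 + 2j) ≤ 2F + 1, and an odd bound halves without loss.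
2*+1+2*≤ : ∀ i j {F} → 4 * i ≤ F → 4 * j < F → 2 * i + 1 + 2 * j ≤ F
2*+1+2*≤ i j {F} 4i≤F 4j<F = s≤s⁻¹ (*-cancelˡ-< 2 _ _ (begin-strict
  2 * (2 * i + 1 + 2 * j)   ≡⟨ solve (i ∷ j ∷ []) ⟩
  4 * i + suc (4 * j) + 1   ≤⟨ +-monoˡ-≤ 1 (+-mono-≤ 4i≤F 4j<F) ⟩
  F + F + 1                 <⟨ n<1+n _ ⟩
  suc (F + F + 1)           ≡⟨ solve (F ∷ []) ⟩
  2 * suc F                 ∎))
  where open ≤-Reasoning

sum-mono-≤ : ∀ {m} {g h : Fin m → ℕ} → (∀ i → g i ≤ h i) → foldr _+_ 0 g ≤ foldr _+_ 0 h
sum-mono-≤ {zero}  g≤h = z≤n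
sum-mono-≤ {suc m} g≤h = +-mono-≤ (g≤h zero) (sum-mono-≤ (g≤h ∘ suc))

sum-mono-< : ∀ {m} {g h : Fin m → ℕ} → (∀ i → g i ≤ h i) → ∀ i → g i < h i →
             foldr _+_ 0 g < foldr _+_ 0 h
sum-mono-< g≤h zero    gi<hi = +-mono-<-≤ gi<hi (sum-mono-≤ (g≤h ∘ suc))
sum-mono-< g≤h (suc i) gi<hi = +-mono-≤-< (g≤h zero) (sum-mono-< (g≤h ∘ suc) i gi<hi)

*-distribˡ-sum : ∀ {m} c (g : Fin m → ℕ) → c * foldr _+_ 0 g ≡ foldr _+_ 0 (λ i → c * g i)
*-distribˡ-sum {zero}  c g = *-zeroʳ c
*-distribˡ-sum {suc m} c g =
  trans (*-distribˡ-+ c (g zero) _) (cong (c * g zero +_) (*-distribˡ-sum c (g ∘ suc)))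

length-concat-tabulate : ∀ {A : Set} {m} (xs : Fin m → List A) →
                         length (concat (tabulate xs)) ≡ foldr _+_ 0 (length ∘ xs)
length-concat-tabulate {m = zero}  xs = refl
length-concat-tabulate {m = suc m} xs =
  trans (length-++ (xs zero)) (cong (length (xs zero) +_) (length-concat-tabulate (xs ∘ suc)))

fromList : ∀ {m} → List (Fin m) → Subset m
fromList []       = ⊥
fromList (x ∷ xs) = ⁅ x ⁆ ∪ fromList xs

∈-fromList⁻ : ∀ {m} {x : Fin m} xs → x ∈ₛ fromList xs → x ∈ xs
∈-fromList⁻ []       x∈ = ⊥-elim (∉⊥ x∈)
∈-fromList⁻ (y ∷ ys) x∈ with x∈p∪q⁻ ⁅ y ⁆ (fromList ys) x∈
... | inj₁ x∈⁅y⁆ = here (x∈⁅y⁆⇒x≡y y x∈⁅y⁆)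
... | inj₂ x∈ys  = there (∈-fromList⁻ ys x∈ys)

length≤∣fromList∣ : ∀ {m} {xs : List (Fin m)} → Unique xs → length xs ≤ ∣ fromList xs ∣
length≤∣fromList∣ []                            = z≤n
length≤∣fromList∣ {xs = x ∷ xs} (x∉xs ∷ unique) =
  ≤-trans (s≤s (length≤∣fromList∣ unique)) (p⊂q⇒∣p∣<∣q∣
    (q⊆p∪q ⁅ x ⁆ (fromList xs) , x , x∈p∪q⁺ (inj₁ (x∈⁅x⁆ x)) ,
     λ x∈ → All.lookup x∉xs (∈-fromList⁻ xs x∈) refl))

Apart : (G : Graph) → Fin (n G) → Fin (n G) → Set
Apart G u v = ¬ Within G u v 1

module _ {G : Graph} where

  adj⇒within : ∀ {u v} → Adj G u v → Within G u v 1
  adj⇒within e = walk⇒within (step e here)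

  apart⇒≢ : ∀ {u v} → Apart G u v → u ≢ v
  apart⇒≢ apart refl = apart (0 , z≤n , here)

  apart-nonadjacent : ∀ {xs u v} → AllPairs (Apart G) xs → u ∈ xs → v ∈ xs → ¬ Adj G u v
  apart-nonadjacent (_ ∷ _)       (here refl) (here refl) e = irrefl G e
  apart-nonadjacent (u-apart ∷ _) (here refl) (there v∈)  e = All.lookup u-apart v∈ (adj⇒within e)
  apart-nonadjacent (v-apart ∷ _) (there u∈)  (here refl) e =
    All.lookup v-apart u∈ (adj⇒within (sym G e))
  apart-nonadjacent (_ ∷ apart)   (there u∈)  (there v∈)  e = apart-nonadjacent apart u∈ v∈ e

  apart-length≤α : ∀ {a xs} → IsIndependenceNumber G a → AllPairs (Apart G) xs → length xs ≤ a
  apart-length≤α {xs = xs} (_ , maximum) apart =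
    ≤-trans (length≤∣fromList∣ (AllPairs.map apart⇒≢ apart))
            (maximum (fromList xs) λ u v u∈ v∈ →
               apart-nonadjacent apart (∈-fromList⁻ xs u∈) (∈-fromList⁻ xs v∈))

argmaxFin : ∀ {m} → (Fin m → ℕ) → Fin m → Fin m
argmaxFin {m} g i₀ = argmax g i₀ (allFin m)

≤-argmaxFin : ∀ {m} (g : Fin m → ℕ) i₀ j → g j ≤ g (argmaxFin g i₀)
≤-argmaxFin {m} g i₀ j = All.lookup (f[xs]≤f[argmax] i₀ (allFin m)) (∈-allFin j)

record LongGeodesic (G : Graph) (v : Fin (n G)) (k : ℕ) : Set where
  field
    end      : Fin (n G)
    len      : ℕ
    k≤len    : k ≤ len
    geodesic : Geodesic {G} v end len

module _ (G : Graph) (adj? : Decidable (Adj G)) where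

  walk? : ∀ u v k → Dec (Walk G u v k)
  walk? u v zero with u ≟ v
  ... | yes refl = yes here
  ... | no u≢v   = no λ { here → u≢v refl }
  walk? u v (suc k) =
    map′ (λ (w , e , p) → step e p) (λ { (step e p) → _ , e , p })
         (any? (λ w → adj? u w ×-dec walk? w v k))

  within? : ∀ u v k → Dec (Within G u v k)
  within? u v k =
    map′ (λ (m , m<1+k , p) → m , s≤s⁻¹ m<1+k , p) (λ (m , m≤k , p) → m , s≤s m≤k , p)
         (anyUpTo? (walk? u v) (suc k))

  distance : ∀ {u v k} → Within G u v k → Σ ℕ (IsDist G u v)
  distance {k = zero}  w = 0 , w , λ _ ()
  distance {u} {v} {suc k} w with within? u v k
  ... | yes w′ = distance w′
  ... | no ¬w′ = suc k , w , λ m m<1+k w″ → ¬w′ (within-mono (s≤s⁻¹ m<1+k) w″)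

  eccentricity : Connected G → ∀ v → Σ ℕ (IsEcc G v)
  eccentricity connected v =
    dist far , (λ u d isDist → ≤-trans (isDist-≤ isDist (proj₁ (isDist[dist] u))) (≤-argmaxFin dist v u))
             , far , isDist[dist] far
    where
      dist : Fin (n G) → ℕ
      dist u = proj₁ (distance (proj₂ (connected v u)))
      isDist[dist] : ∀ u → IsDist G v u (dist u)
      isDist[dist] u = proj₂ (distance (proj₂ (connected v u)))
      far : Fin (n G)
      far = argmaxFin dist v

  broadcast-geodesic : Connected G → ∀ {f} → IsBroadcast G f → ∀ v → LongGeodesic G v (f v)
  broadcast-geodesic connected broadcast v =
    let e , ecc@(_ , u , isDist) = eccentricity connected v in
    record { end = u ; len = e ; k≤len = broadcast v e ecc ; geodesic = isDist⇒geodesic isDist }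

module Packing (G : Graph) (f : Fin (n G) → ℕ) (independent : HearingIndependent G f)
               (ray : ∀ v → LongGeodesic G v (f v)) (v₀ : Fin (n G)) where

  private
    Vertex = Fin (n G)

  open LongGeodesic

  loudest : Vertex
  loudest = argmaxFin f v₀

  f≤f[loudest] : ∀ v → f v ≤ f loudest
  f≤f[loudest] = ≤-argmaxFin f v₀

  -- The loudest vertex gets one extra unit of budget; this makes the final bound strict.
  bonus : Vertex → ℕ
  bonus v with v ≟ loudest
  ... | yes _ = 1
  ... | no  _ = 0

  bonus≤1 : ∀ v → bonus v ≤ 1
  bonus≤1 v with v ≟ loudest
  ... | yes _ = ≤-refl
  ... | no  _ = z≤n

  bonus-loudest : bonus loudest ≡ 1
  bonus-loudest with loudest ≟ loudest
  ... | yes _     = refl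
  ... | no  ≢self = contradiction refl ≢self

  bonus-quiet : ∀ {v} → v ≢ loudest → bonus v ≡ 0
  bonus-quiet {v} v≢loudest with v ≟ loudest
  ... | yes v≡loudest = contradiction v≡loudest v≢loudest
  ... | no  _         = refl

  quota : Vertex → ℕ
  quota v = ⌈ f v + bonus v /4⌉

  4*<f+bonus : ∀ {v i} → i < quota v → 4 * i < f v + bonus v
  4*<f+bonus {v} = <⌈/4⌉⇒4*< (f v + bonus v)

  4*≤f : ∀ {v i} → i < quota v → 4 * i ≤ f v
  4*≤f {v} {i} i<q = s≤s⁻¹ (begin-strict
    4 * i           <⟨ 4*<f+bonus i<q ⟩
    f v + bonus v   ≤⟨ +-monoʳ-≤ (f v) (bonus≤1 v) ⟩
    f v + 1         ≡⟨ +-comm (f v) 1 ⟩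
    suc (f v)       ∎)
    where open ≤-Reasoning

  4*<f : ∀ {v i} → v ≢ loudest → i < quota v → 4 * i < f v
  4*<f {v} {i} v≢loudest i<q =
    subst (4 * i <_) f+bonus≡f (4*<f+bonus i<q)
    where
      f+bonus≡f : f v + bonus v ≡ f v
      f+bonus≡f = trans (cong (f v +_) (bonus-quiet v≢loudest)) (+-identityʳ (f v))

  f≤4*quota : ∀ v → f v ≤ 4 * quota v
  f≤4*quota v = ≤-trans (m≤m+n (f v) (bonus v)) (≤4*⌈/4⌉ (f v + bonus v))

  f[loudest]<4*quota : f loudest < 4 * quota loudest
  f[loudest]<4*quota = begin
    suc (f loudest)             ≡⟨ +-comm 1 (f loudest) ⟩
    f loudest + 1               ≡⟨ cong (f loudest +_) bonus-loudest ⟨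
    f loudest + bonus loudest   ≤⟨ ≤4*⌈/4⌉ _ ⟩
    4 * quota loudest           ∎
    where open ≤-Reasoning

  point : Vertex → ℕ → Vertex
  point v i = vertexAt (Geodesic.walk (geodesic (ray v))) (2 * i)

  2*≤len : ∀ {v i} → i < quota v → 2 * i ≤ len (ray v)
  2*≤len {v} {i} i<q =
    ≤-trans (*-monoˡ-≤ i {2} {4} (s≤s (s≤s z≤n))) (≤-trans (4*≤f i<q) (k≤len (ray v)))

  within-point : ∀ {v i} → i < quota v → Within G v (point v i) (2 * i)
  within-point {v} {i} i<q =
    walk⇒within (prefix (Geodesic.walk (geodesic (ray v))) (2 * i) (2*≤len i<q))

  ray-apart : ∀ {v i j} → i < j → j < quota v → Apart G (point v i) (point v j)
  ray-apart {v} {i} {j} i<j j<q =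
    geodesic-apart (geodesic (ray v)) (subst (_≤ 2 * j) 2+2*i≡ (*-monoʳ-≤ 2 i<j)) (2*≤len j<q)
    where
      2+2*i≡ : 2 * suc i ≡ suc (2 * i + 1)
      2+2*i≡ = solve (i ∷ [])

  centres-within : ∀ {v x i j} → i < quota v → j < quota x →
                   Within G (point v i) (point x j) 1 → Within G v x (2 * i + 1 + 2 * j)
  centres-within i<q j<q close =
    within-trans (within-trans (within-point i<q) close) (within-sym (within-point j<q))

  quieter-apart : ∀ {u w} i j → u ≢ w → f w ≤ f u → 4 * i ≤ f u → 4 * j < f w →
                  ¬ Within G u w (2 * i + 1 + 2 * j)
  quieter-apart i j u≢w fw≤fu 4i≤fu 4j<fw close =
    independent _ _ (λ w≡u → u≢w (≡.sym w≡u)) 0<fw (≤-trans 0<fw fw≤fu)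
      (within-mono (2*+1+2*≤ i j 4i≤fu (<-≤-trans 4j<fw fw≤fu)) (within-sym close))
    where
      0<fw = ≤-trans (s≤s z≤n) 4j<fw

  louder-or-quieter : ∀ {v x} → v ≢ x → (f x ≤ f v × x ≢ loudest) ⊎ (f v ≤ f x × v ≢ loudest)
  louder-or-quieter {v} {x} v≢x with x ≟ loudest | f x ≤? f v
  ... | yes refl | _        = inj₂ (f≤f[loudest] v , v≢x)
  ... | no x≢l   | yes fx≤fv = inj₁ (fx≤fv , x≢l)
  ... | no x≢l   | no fx≰fv  = inj₂ (≰⇒≥ fx≰fv , λ { refl → fx≰fv (f≤f[loudest] x) })

  rays-apart : ∀ {v x i j} → v ≢ x → i < quota v → j < quota x → Apart G (point v i) (point x j)
  rays-apart {i = i} {j} v≢x i<q j<q close with louder-or-quieter v≢x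
  ... | inj₁ (fx≤fv , x≢l) =
    quieter-apart i j v≢x fx≤fv (4*≤f i<q) (4*<f x≢l j<q) (centres-within i<q j<q close)
  ... | inj₂ (fv≤fx , v≢l) =
    quieter-apart j i (λ x≡v → v≢x (≡.sym x≡v)) fv≤fx (4*≤f j<q) (4*<f v≢l i<q)
      (centres-within j<q i<q (within-sym close))

  points : Vertex → List Vertex
  points v = tabulate {n = quota v} (point v ∘ toℕ)

  allPoints : List Vertex
  allPoints = concat (tabulate points)

  allPoints-apart : AllPairs (Apart G) allPoints
  allPoints-apart = AllPairs.concat⁺
    (All.tabulate⁺ λ v → AllPairs.tabulate⁺-< λ {i} {j} i<j → ray-apart i<j (toℕ<n j))
    (AllPairs.tabulate⁺ λ v≢x → All.tabulate⁺ λ i → All.tabulate⁺ λ j →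
       rays-apart v≢x (toℕ<n i) (toℕ<n j))

  Σquota≤length : foldr _+_ 0 quota ≤ length allPoints
  Σquota≤length = ≤-trans (sum-mono-≤ (λ v → ≤-reflexive (≡.sym (length-tabulate (point v ∘ toℕ)))))
                          (≤-reflexive (≡.sym (length-concat-tabulate points)))

  cost<4α : ∀ {a} → IsIndependenceNumber G a → cost f < 4 * a
  cost<4α {a} α = begin-strict
    cost f                            <⟨ sum-mono-< f≤4*quota loudest f[loudest]<4*quota ⟩
    foldr _+_ 0 (λ v → 4 * quota v)   ≡⟨ *-distribˡ-sum 4 quota ⟨
    4 * foldr _+_ 0 quota             ≤⟨ *-monoʳ-≤ 4 Σquota≤α ⟩
    4 * a                             ∎
    where
      open ≤-Reasoning
      Σquota≤α = ≤-trans Σquota≤length (apart-length≤α α allPoints-apart)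

¬¬-∀-Fin : ∀ {m} {P : Fin m → Set} → (∀ i → ¬ ¬ P i) → ¬ ¬ (∀ i → P i)
¬¬-∀-Fin {zero}  _   ¬all = ¬all λ ()
¬¬-∀-Fin {suc m} ¬¬P ¬all = ¬¬P zero λ P0 → ¬¬-∀-Fin (¬¬P ∘ suc) λ Psuc →
  ¬all λ { zero → P0 ; (suc i) → Psuc i }

corollary3p2 : (G : Graph) → Nontrivial G → Connected G →
    (a : ℕ) → IsIndependenceNumber G a →
    (f : Fin (n G) → ℕ) → IsBroadcast G f → HearingIndependent G f →
    cost f < 4 * a
corollary3p2 G nontrivial connected a α f broadcast independent =
  decidable-stable (cost f <? 4 * a) (¬¬-map bound ¬¬adj?)
  where
    -- Adjacency need not be decidable, but the goal is, so we may assume it is.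
    ¬¬adj? : ¬ ¬ Decidable (Adj G)
    ¬¬adj? = ¬¬-∀-Fin λ u → ¬¬-∀-Fin λ v → ¬¬-excluded-middle
    bound : Decidable (Adj G) → cost f < 4 * a
    bound adj? = Packing.cost<4α G f independent (broadcast-geodesic G adj? connected broadcast)
                   (fromℕ< (<-≤-trans (s≤s z≤n) nontrivial)) α
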